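{- Let $G$ be a finite simple graph on $n\ge 4$ vertices with minimum degree $\delta(G)$. If \[ \delta(G)\ge\log_2(n(n+2))-2, \] then $D(G,x)$ is unimodal with mode $\lceil n/2\rceil$, i.e. $d_0(G)\le\cdots\le d_{\lceil n/2\rceil}(G)\ge\cdots\ge d_n(G)$.
   Context: A set $S\subseteq V(G)$ is dominating if every vertex of $G$ is in $S$ or adjacent to a vertex of $S$; $d_j(G)$ is the number of dominating sets of size $j$ and $D(G,x)=\sum_{j=0}^n d_j(G)x^j$. -}

module Defs where

open import Data.Nat using (ℕ; zero; suc; _+_; _≡ᵇ_; _⊔_; _⊓_)
open import Data.Nat.Properties using (≤-refl)
open import Data.Bool using (Bool; true; false; _∧_; _∨_; if_then_else_)
open import Data.Fin using (Fin; zero; suc)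
open import Data.Vec using (Vec; []; _∷_; lookup; tabulate)
open import Data.List using (List; []; _∷_; map; _++_; length; filterᵇ; allFin; foldr)
open import Data.Bool.ListAction using (any; all)
open import Data.Fin.Subset using (Subset; ∣_∣)
open import Relation.Binary.PropositionalEquality using (_≡_)

record Graph (n : ℕ) : Set where
  field
    adj       : Fin n → Fin n → Bool
    adj-sym   : ∀ u v → adj u v ≡ adj v u
    adj-irrefl : ∀ v → adj v v ≡ false
open Graph public

degree : ∀ {n} → Graph n → Fin n → ℕ
degree G v = length (filterᵇ (adj G v) (allFin _))

-- minimum degree δ(G) = min over vertices v of degree v
-- (convention: 0 for the empty graph, irrelevant here since n ≥ 4)
minDegree : ∀ {n} → Graph n → ℕ
minDegree {zero} G = zero
minDegree {suc n} G = foldr (λ v m → degree G v ⊓ m) (degree G zero) (allFin (suc n))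

allSubsets : (n : ℕ) → List (Subset n)
allSubsets zero = [] ∷ []
allSubsets (suc n) = map (true ∷_) (allSubsets n) ++ map (false ∷_) (allSubsets n)

isDominating : ∀ {n} → Graph n → Subset n → Bool
isDominating {n} G S =
  all (λ v → lookup S v ∨ any (λ u → lookup S u ∧ adj G v u) (allFin n)) (allFin n)

d : ∀ {n} → Graph n → ℕ → ℕ
d {n} G j = length (filterᵇ (λ S → (∣ S ∣ ≡ᵇ j) ∧ isDominating G S) (allSubsets n))

ceilHalf : ℕ → ℕ
ceilHalf zero = zero
ceilHalf (suc zero) = suc zero
ceilHalf (suc (suc n)) = suc (ceilHalf n)

-- Increasing half: the dominating sets form an up-closed family, and an up-closed family
-- with u_j members of size j satisfies the local LYM inequality (n − j)·u_j ≤ (j + 1)·u_{j+1}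
-- (induction on n, splitting on the first element); hence u_j ≤ u_{j+1} while 2j + 1 ≤ n.
-- Decreasing half, n ≤ 2i: a non-dominating i-set avoids the closed neighbourhood of some
-- vertex, which has at least δ + 1 elements, so C(n,i) ≤ d_i + n·C(n−δ−1,i).  Since
-- C(m+1,i) ≥ 2·C(m,i) for m < 2i, the hypothesis n(n+2) ≤ 2^(δ+2) gives
-- (n+2)·n·C(n−δ−1,i) ≤ 2·C(n,i); with (n+2)·C(n,i+1) ≤ n·C(n,i) this yields
-- C(n,i+1) + n·C(n−δ−1,i) ≤ C(n,i), whence d_{i+1} ≤ C(n,i+1) ≤ d_i.

{-# OPTIONS --safe #-}
module Submission where

open import Defs
open import Data.Nat using (ℕ; zero; suc; _+_; _*_; _^_; _≤_; _<_; _∸_; _≡ᵇ_; _⊓_; z≤n; s≤s;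
  _≤′_; ≤′-refl; ≤′-step; NonZero)
open import Data.Nat.Properties
open import Data.Nat.Combinatorics using (_C_; nCk+nC[k+1]≡[n+1]C[k+1]; nC1≡n)
open import Data.Nat.Tactic.RingSolver using (solve-∀)
open import Data.Bool using (Bool; true; false; T; _∧_; _∨_)
open import Data.Bool.Properties using (T-∧; T-∨; T-≡)
open import Data.Bool.ListAction using (any)
open import Data.Product as Product using (_×_; _,_; proj₁; proj₂; ∃-syntax)
open import Data.Sum as Sum using (_⊎_; inj₁; inj₂; [_,_])
open import Data.Empty using (⊥-elim)
open import Data.Unit using (tt)
open import Data.Fin using (Fin; zero; suc)
open import Data.Fin.Subset using (Subset; inside; outside; _∈_; _⊆_; ∣_∣; ∁; ⁅_⁆; _∪_; ⊤)
open import Data.Fin.Subset.Properties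
  using (_⊆?_; s⊆s; out⊆; ⊆-refl; ⊆⊤; ∣⊤∣≡n; ∣p∣≤n; p⊂q⇒∣p∣<∣q∣; ∣∁p∣≡n∸∣p∣;
         x∈⁅x⁆; x∈⁅y⁆⇒x≡y; x∈p∪q⁻; x∈p∪q⁺; q⊆p∪q; x∉p⇒x∈∁p)
open import Data.Vec as Vec using ([]; _∷_; lookup; here; there)
open import Data.Vec.Properties using (lookup∘tabulate)
open import Data.List as List using (List; []; _∷_; map; _++_; length; filterᵇ; allFin; foldr)
open import Data.List.Properties using (filter-++; length-++; filter-none)
open import Data.List.Relation.Unary.All as All using (universal)
open import Data.List.Relation.Unary.All.Properties using (all⁺; all⁻; ¬All⇒Any¬)
open import Data.List.Relation.Unary.Any as Any using (here; there)
open import Data.List.Relation.Unary.Any.Properties using (any⁺; any⁻; tabulate⁺; tabulate⁻)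
open import Data.List.Membership.Propositional using () renaming (_∈_ to _∈ₗ_)
open import Data.List.Membership.Propositional.Properties using (∈-allFin)
open import Function using (_∘_; id; Equivalence)
open import Relation.Nullary using (¬_; yes; no; does)
open import Relation.Nullary.Decidable using (T?; dec-true)
open import Relation.Binary.PropositionalEquality
  using (_≡_; refl; sym; trans; cong; cong₂; subst; module ≡-Reasoning)

open Equivalence using (to; from)

private
  variable
    A B : Set
    n k : ℕ

count : (A → Bool) → List A → ℕ
count p xs = length (filterᵇ p xs)

count-++ : ∀ (p : A → Bool) xs ys → count p (xs ++ ys) ≡ count p xs + count p ys
count-++ p xs ys = trans (cong length (filter-++ (T? ∘ p) xs ys)) (length-++ (filterᵇ p xs))

count-map : ∀ (p : B → Bool) (f : A → B) xs → count p (map f xs) ≡ count (p ∘ f) xs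
count-map p f []       = refl
count-map p f (x ∷ xs) with p (f x)
... | true  = cong suc (count-map p f xs)
... | false = count-map p f xs

count-none : ∀ (p : A → Bool) xs → (∀ x → ¬ T (p x)) → count p xs ≡ 0
count-none p xs ¬p = cong length (filter-none (T? ∘ p) (universal ¬p xs))

count-mono : ∀ (p q : A → Bool) → (∀ x → T (p x) → T (q x)) → ∀ xs → count p xs ≤ count q xs
count-mono p q p⇒q []       = z≤n
count-mono p q p⇒q (x ∷ xs) with p x | q x | p⇒q x
... | true  | true  | _     = s≤s (count-mono p q p⇒q xs)
... | true  | false | px⇒qx = ⊥-elim (px⇒qx tt)
... | false | true  | _     = m≤n⇒m≤1+n (count-mono p q p⇒q xs)
... | false | false | _     = count-mono p q p⇒q xs

count-∨ : ∀ (p q : A → Bool) xs → count (λ x → p x ∨ q x) xs ≤ count p xs + count q xs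
count-∨ p q []       = z≤n
count-∨ p q (x ∷ xs) with p x | q x | count-∨ p q xs
... | true  | true  | ih = s≤s (≤-trans ih (+-monoʳ-≤ (count p xs) (n≤1+n _)))
... | true  | false | ih = s≤s ih
... | false | true  | ih = ≤-trans (s≤s ih) (≤-reflexive (sym (+-suc _ _)))
... | false | false | ih = ih

count-cover : ∀ (p q : A → Bool) (h : Fin k → A → Bool) xs {M} →
  (∀ x → T (p x) → T (q x) ⊎ ∃[ v ] T (h v x)) →
  (∀ v → count (h v) xs ≤ M) →
  count p xs ≤ count q xs + k * M
count-cover {k = zero} p q h xs cover _ = begin
  count p xs     ≤⟨ count-mono p q (λ x → [ id , (λ ()) ∘ proj₁ ] ∘ cover x) xs ⟩
  count q xs     ≡⟨ +-identityʳ _ ⟨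
  count q xs + 0 ∎
  where open ≤-Reasoning
count-cover {k = suc k} p q h xs {M} cover bound = begin
  count p xs                             ≤⟨ count-cover p q∨h₀ (h ∘ suc) xs cover′ (bound ∘ suc) ⟩
  count q∨h₀ xs + k * M                  ≤⟨ +-monoˡ-≤ (k * M) (count-∨ q (h zero) xs) ⟩
  count q xs + count (h zero) xs + k * M ≤⟨ +-monoˡ-≤ (k * M) (+-monoʳ-≤ (count q xs) (bound zero)) ⟩
  count q xs + M + k * M                 ≡⟨ +-assoc (count q xs) M (k * M) ⟩
  count q xs + suc k * M                 ∎
  where
  open ≤-Reasoning
  q∨h₀ = λ x → q x ∨ h zero x
  cover′ : ∀ x → T (p x) → T (q∨h₀ x) ⊎ ∃[ v ] T (h (suc v) x)
  cover′ x px with cover x px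
  ... | inj₁ qx           = inj₁ (from T-∨ (inj₁ qx))
  ... | inj₂ (zero , hx)  = inj₁ (from T-∨ (inj₂ hx))
  ... | inj₂ (suc v , hx) = inj₂ (v , hx)

foldr-⊓-≤ : ∀ (f : A → ℕ) b {x xs} → x ∈ₗ xs → foldr (λ y m → f y ⊓ m) b xs ≤ f x
foldr-⊓-≤ f b (here refl)  = m⊓n≤m _ _
foldr-⊓-≤ f b (there x∈xs) = ≤-trans (m⊓n≤n _ _) (foldr-⊓-≤ f b x∈xs)

C-pascal : ∀ n k → suc n C suc k ≡ n C k + n C suc k
C-pascal n k = sym (nCk+nC[k+1]≡[n+1]C[k+1] n k)

[k+1]*nC[k+1]+k*nCk≡n*nCk : ∀ n k → suc k * (n C suc k) + k * (n C k) ≡ n * (n C k)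
[k+1]*nC[k+1]+k*nCk≡n*nCk n zero =
  trans (+-identityʳ _) (trans (*-identityˡ _) (trans (nC1≡n n) (sym (*-identityʳ n))))
[k+1]*nC[k+1]+k*nCk≡n*nCk zero (suc k) = cong₂ _+_ (*-zeroʳ (suc (suc k))) (*-zeroʳ (suc k))
[k+1]*nC[k+1]+k*nCk≡n*nCk (suc n) (suc k) = begin
  suc (suc k) * (suc n C suc (suc k)) + suc k * (suc n C suc k)
    ≡⟨ cong₂ (λ x y → suc (suc k) * x + suc k * y) (C-pascal n (suc k)) (C-pascal n k) ⟩
  suc (suc k) * (b + c) + suc k * (a + b)
    ≡⟨ regroup k a b c ⟩
  (suc (suc k) * c + suc k * b) + (suc k * b + k * a) + (a + b)
    ≡⟨ cong₂ (λ x y → x + y + (a + b)) ([k+1]*nC[k+1]+k*nCk≡n*nCk n (suc k))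
                                       ([k+1]*nC[k+1]+k*nCk≡n*nCk n k) ⟩
  n * b + n * a + (a + b)
    ≡⟨ collect n a b ⟩
  suc n * (a + b)
    ≡⟨ cong (suc n *_) (C-pascal n k) ⟨
  suc n * (suc n C suc k) ∎
  where
  open ≡-Reasoning
  a = n C k
  b = n C suc k
  c = n C suc (suc k)
  regroup : ∀ k a b c → suc (suc k) * (b + c) + suc k * (a + b)
                      ≡ (suc (suc k) * c + suc k * b) + (suc k * b + k * a) + (a + b)
  regroup = solve-∀
  collect : ∀ n a b → n * b + n * a + (a + b) ≡ suc n * (a + b)
  collect = solve-∀

nCk≤[n+1]Ck : ∀ n k → n C k ≤ suc n C k
nCk≤[n+1]Ck n zero    = ≤-refl
nCk≤[n+1]Ck n (suc k) = ≤-trans (m≤n+m _ _) (≤-reflexive (sym (C-pascal n k)))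

C-monoˡ-≤ : ∀ {m n} k → m ≤ n → m C k ≤ n C k
C-monoˡ-≤ k m≤n = go (≤⇒≤′ m≤n)
  where
  go : ∀ {m n} → m ≤′ n → m C k ≤ n C k
  go ≤′-refl        = ≤-refl
  go (≤′-step m≤′n) = ≤-trans (go m≤′n) (nCk≤[n+1]Ck _ k)

nC[k+1]≤nCk : ∀ {n} k → n ≤ suc k + k → n C suc k ≤ n C k
nC[k+1]≤nCk {n} k n≤2k+1 = *-cancelˡ-≤ (suc k) (+-cancelʳ-≤ (k * X) _ _ (begin
  suc k * (n C suc k) + k * X ≡⟨ [k+1]*nC[k+1]+k*nCk≡n*nCk n k ⟩
  n * X                       ≤⟨ *-monoˡ-≤ X n≤2k+1 ⟩
  (suc k + k) * X             ≡⟨ *-distribʳ-+ X (suc k) k ⟩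
  suc k * X + k * X           ∎))
  where
  open ≤-Reasoning
  X = n C k

2*nCk≤[n+1]Ck : ∀ {n} k → suc n ≤ k + k → 2 * (n C k) ≤ suc n C k
2*nCk≤[n+1]Ck {n} (suc k) n+1≤2k+2 = begin
  2 * (n C suc k)       ≡⟨ cong (n C suc k +_) (+-identityʳ _) ⟩
  n C suc k + n C suc k ≤⟨ +-monoˡ-≤ (n C suc k) (nC[k+1]≤nCk k n≤2k+1) ⟩
  n C k + n C suc k     ≡⟨ C-pascal n k ⟨
  suc n C suc k         ∎
  where
  open ≤-Reasoning
  n≤2k+1 : n ≤ suc k + k
  n≤2k+1 = ≤-pred (subst (suc n ≤_) (cong suc (+-suc k k)) n+1≤2k+2)

2^a*nCk≤[n+a]Ck : ∀ {n} a k → n + a ≤ k + k → 2 ^ a * (n C k) ≤ (n + a) C k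
2^a*nCk≤[n+a]Ck {n} zero k _ =
  ≤-reflexive (trans (+-identityʳ _) (cong (_C k) (sym (+-identityʳ n))))
2^a*nCk≤[n+a]Ck {n} (suc a) k n+a+1≤2k = begin
  2 * 2 ^ a * (n C k)   ≡⟨ *-assoc 2 (2 ^ a) (n C k) ⟩
  2 * (2 ^ a * (n C k)) ≤⟨ *-monoʳ-≤ 2 (2^a*nCk≤[n+a]Ck a k (≤-trans (+-monoʳ-≤ n (n≤1+n a)) n+a+1≤2k)) ⟩
  2 * ((n + a) C k)     ≤⟨ 2*nCk≤[n+1]Ck k (subst (_≤ k + k) (+-suc n a) n+a+1≤2k) ⟩
  suc (n + a) C k       ≡⟨ cong (_C k) (+-suc n a) ⟨
  (n + suc a) C k       ∎
  where open ≤-Reasoning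

[n+2]*nC[k+1]≤n*nCk : ∀ {n} k → n ≤ k + k → (2 + n) * (n C suc k) ≤ n * (n C k)
[n+2]*nC[k+1]≤n*nCk {n} k n≤2k = *-cancelˡ-≤ (suc k) (+-cancelʳ-≤ ((2 + n) * (k * X)) _ _ (begin
  suc k * ((2 + n) * Y) + (2 + n) * (k * X) ≡⟨ factor k n X Y ⟩
  (2 + n) * (suc k * Y + k * X)             ≡⟨ cong ((2 + n) *_) ([k+1]*nC[k+1]+k*nCk≡n*nCk n k) ⟩
  (2 + n) * (n * X)                         ≡⟨ expand n X ⟩
  (n + n * (n + 1)) * X                     ≤⟨ *-monoˡ-≤ X (+-monoʳ-≤ n (*-monoˡ-≤ (n + 1) n≤2k)) ⟩
  (n + (k + k) * (n + 1)) * X               ≡⟨ regroup k n X ⟩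
  suc k * (n * X) + (2 + n) * (k * X)       ∎))
  where
  open ≤-Reasoning
  X = n C k
  Y = n C suc k
  factor : ∀ k n X Y → suc k * ((2 + n) * Y) + (2 + n) * (k * X) ≡ (2 + n) * (suc k * Y + k * X)
  factor = solve-∀
  expand : ∀ n X → (2 + n) * (n * X) ≡ (n + n * (n + 1)) * X
  expand = solve-∀
  regroup : ∀ k n X → (n + (k + k) * (n + 1)) * X ≡ suc k * (n * X) + (2 + n) * (k * X)
  regroup = solve-∀

countSubsets : (Subset n → Bool) → ℕ → ℕ
countSubsets {n} P j = count (λ S → (∣ S ∣ ≡ᵇ j) ∧ P S) (allSubsets n)

countSubsets-zero : ∀ (P : Subset (suc n) → Bool) →
  countSubsets P 0 ≡ countSubsets (P ∘ (outside ∷_)) 0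
countSubsets-zero {n} P =
  trans (count-++ _ (map (inside ∷_) (allSubsets n)) (map (outside ∷_) (allSubsets n)))
        (cong₂ _+_ (trans (count-map _ _ (allSubsets n)) (count-none _ (allSubsets n) (λ _ ())))
                   (count-map _ _ (allSubsets n)))

countSubsets-suc : ∀ (P : Subset (suc n) → Bool) j →
  countSubsets P (suc j) ≡ countSubsets (P ∘ (inside ∷_)) j + countSubsets (P ∘ (outside ∷_)) (suc j)
countSubsets-suc {n} P j =
  trans (count-++ _ (map (inside ∷_) (allSubsets n)) (map (outside ∷_) (allSubsets n)))
        (cong₂ _+_ (count-map _ _ (allSubsets n)) (count-map _ _ (allSubsets n)))

countSubsets-mono : ∀ {P Q : Subset n → Bool} → (∀ S → T (P S) → T (Q S)) →
  ∀ j → countSubsets P j ≤ countSubsets Q j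
countSubsets-mono {n} {P} {Q} P⇒Q j = count-mono _ _ sized (allSubsets n)
  where
  sized : ∀ S → T ((∣ S ∣ ≡ᵇ j) ∧ P S) → T ((∣ S ∣ ≡ᵇ j) ∧ Q S)
  sized S with ∣ S ∣ ≡ᵇ j
  ... | true  = P⇒Q S
  ... | false = λ ()

countSubsets-cover : ∀ (P Q : Subset n → Bool) (R : Fin k → Subset n → Bool) j {M} →
  (∀ S → T (P S) → T (Q S) ⊎ ∃[ v ] T (R v S)) →
  (∀ v → countSubsets (R v) j ≤ M) →
  countSubsets P j ≤ countSubsets Q j + k * M
countSubsets-cover {n} P Q R j cover = count-cover _ _ _ (allSubsets n) sized
  where
  sized : ∀ S → T ((∣ S ∣ ≡ᵇ j) ∧ P S) → T ((∣ S ∣ ≡ᵇ j) ∧ Q S) ⊎ ∃[ v ] T ((∣ S ∣ ≡ᵇ j) ∧ R v S)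
  sized S with ∣ S ∣ ≡ᵇ j
  ... | true  = cover S
  ... | false = λ ()

⊆⇒T-⊆? : ∀ {S B : Subset n} → S ⊆ B → T (does (S ⊆? B))
⊆⇒T-⊆? {S = S} {B} S⊆B = from T-≡ (dec-true (S ⊆? B) S⊆B)

countSubsets-⊆ : ∀ (B : Subset n) j → countSubsets (λ S → does (S ⊆? B)) j ≡ ∣ B ∣ C j
countSubsets-⊆ []           zero    = refl
countSubsets-⊆ []           (suc j) = refl
countSubsets-⊆ (s ∷ B)      zero    =
  trans (countSubsets-zero (λ S → does (S ⊆? s ∷ B))) (countSubsets-⊆ B zero)
countSubsets-⊆ {suc n} (outside ∷ B) (suc j) =
  trans (countSubsets-suc (λ S → does (S ⊆? outside ∷ B)) j)
        (cong₂ _+_ (count-none (λ S → (∣ S ∣ ≡ᵇ j) ∧ false) (allSubsets n) (λ S → proj₂ ∘ to T-∧))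
                   (countSubsets-⊆ B (suc j)))
countSubsets-⊆ (inside ∷ B)  (suc j) =
  trans (countSubsets-suc (λ S → does (S ⊆? inside ∷ B)) j)
        (trans (cong₂ _+_ (countSubsets-⊆ B j) (countSubsets-⊆ B (suc j)))
               (nCk+nC[k+1]≡[n+1]C[k+1] ∣ B ∣ j))

countSubsets-true : ∀ j → countSubsets {n} (λ _ → true) j ≡ n C j
countSubsets-true {n} j = begin
  countSubsets {n} (λ _ → true) j          ≡⟨ ≤-antisym (countSubsets-mono {n} (λ S _ → ⊆⇒T-⊆? {S = S} ⊆⊤) j)
                                                        (countSubsets-mono {n} (λ _ _ → tt) j) ⟩
  countSubsets {n} (λ S → does (S ⊆? ⊤)) j ≡⟨ countSubsets-⊆ (⊤ {n}) j ⟩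
  ∣ ⊤ {n} ∣ C j                            ≡⟨ cong (_C j) (∣⊤∣≡n n) ⟩
  n C j                                    ∎
  where open ≡-Reasoning

UpClosed : (Subset n → Bool) → Set
UpClosed P = ∀ {S S′} → S ⊆ S′ → T (P S) → T (P S′)

upClosed-∷ : ∀ {P : Subset (suc n) → Bool} s → UpClosed P → UpClosed (P ∘ (s ∷_))
upClosed-∷ s up = up ∘ s⊆s

upClosed-outside≤inside : ∀ {P : Subset (suc n) → Bool} → UpClosed P →
  ∀ j → countSubsets (P ∘ (outside ∷_)) j ≤ countSubsets (P ∘ (inside ∷_)) j
upClosed-outside≤inside {n} {P} up = countSubsets-mono {n} {P ∘ (outside ∷_)} (λ S → up (out⊆ ⊆-refl))

-- (n ∸ j) * u j ≤ suc j * u (suc j) with u = countSubsets P, rearranged to avoid truncated subtraction.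
countSubsets-upClosed-localLYM : ∀ {P : Subset n → Bool} → UpClosed P → ∀ j →
  n * countSubsets P j ≤ suc j * countSubsets P (suc j) + j * countSubsets P j
countSubsets-upClosed-localLYM {zero}  up j = z≤n
countSubsets-upClosed-localLYM {suc n} {P} up zero = begin
  suc n * countSubsets P 0  ≡⟨ cong (suc n *_) (countSubsets-zero P) ⟩
  b 0 + n * b 0             ≤⟨ +-mono-≤ (upClosed-outside≤inside up 0)
                                          (countSubsets-upClosed-localLYM (upClosed-∷ outside up) 0) ⟩
  a 0 + (1 * b 1 + 0)       ≡⟨ regroup₀ (a 0) (b 1) ⟩
  1 * (a 0 + b 1) + 0       ≡⟨ cong (λ x → 1 * x + 0) (countSubsets-suc P 0) ⟨
  1 * countSubsets P 1 + 0  ∎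
  where
  open ≤-Reasoning
  a = countSubsets (P ∘ (inside ∷_))
  b = countSubsets (P ∘ (outside ∷_))
  regroup₀ : ∀ x y → x + (1 * y + 0) ≡ 1 * (x + y) + 0
  regroup₀ = solve-∀
countSubsets-upClosed-localLYM {suc n} {P} up (suc j) = begin
  suc n * countSubsets P (suc j)
    ≡⟨ cong (suc n *_) (countSubsets-suc P j) ⟩
  suc n * (a j + b (suc j))
    ≡⟨ expand n (a j) (b (suc j)) ⟩
  (a j + n * a j) + (b (suc j) + n * b (suc j))
    ≤⟨ +-mono-≤ (+-monoʳ-≤ (a j) (countSubsets-upClosed-localLYM (upClosed-∷ inside up) j))
                (+-mono-≤ (upClosed-outside≤inside up (suc j))
                          (countSubsets-upClosed-localLYM (upClosed-∷ outside up) (suc j))) ⟩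
  (a j + (suc j * a (suc j) + j * a j)) + (a (suc j) + (suc (suc j) * b (suc (suc j)) + suc j * b (suc j)))
    ≡⟨ regroup j (a j) (a (suc j)) (b (suc j)) (b (suc (suc j))) ⟩
  suc (suc j) * (a (suc j) + b (suc (suc j))) + suc j * (a j + b (suc j))
    ≡⟨ cong₂ (λ x y → suc (suc j) * x + suc j * y) (countSubsets-suc P (suc j)) (countSubsets-suc P j) ⟨
  suc (suc j) * countSubsets P (suc (suc j)) + suc j * countSubsets P (suc j) ∎
  where
  open ≤-Reasoning
  a = countSubsets (P ∘ (inside ∷_))
  b = countSubsets (P ∘ (outside ∷_))
  expand : ∀ n x y → suc n * (x + y) ≡ (x + n * x) + (y + n * y)
  expand = solve-∀
  regroup : ∀ j a₀ a₁ b₁ b₂ →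
    (a₀ + (suc j * a₁ + j * a₀)) + (a₁ + (suc (suc j) * b₂ + suc j * b₁))
      ≡ suc (suc j) * (a₁ + b₂) + suc j * (a₀ + b₁)
  regroup = solve-∀

countSubsets-upClosed-increasing : ∀ {P : Subset n → Bool} → UpClosed P →
  ∀ {j} → suc j + j ≤ n → countSubsets P j ≤ countSubsets P (suc j)
countSubsets-upClosed-increasing {n} {P} up {j} 2j+1≤n =
  *-cancelˡ-≤ (suc j) (+-cancelʳ-≤ (j * u j) _ _ (begin
    suc j * u j + j * u j           ≡⟨ *-distribʳ-+ (u j) (suc j) j ⟨
    (suc j + j) * u j               ≤⟨ *-monoˡ-≤ (u j) 2j+1≤n ⟩
    n * u j                         ≤⟨ countSubsets-upClosed-localLYM up j ⟩
    suc j * u (suc j) + j * u j     ∎))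
  where
  open ≤-Reasoning
  u = countSubsets P

lookup⇒∈ : ∀ (S : Subset n) x → T (lookup S x) → x ∈ S
lookup⇒∈ (inside ∷ S) zero    _ = here
lookup⇒∈ (_ ∷ S)      (suc x) t = there (lookup⇒∈ S x t)

∈⇒lookup : ∀ {S : Subset n} {x} → x ∈ S → T (lookup S x)
∈⇒lookup here        = tt
∈⇒lookup (there x∈S) = ∈⇒lookup x∈S

dominated : Graph n → Subset n → Fin n → Bool
dominated {n} G S v = lookup S v ∨ any (λ u → lookup S u ∧ adj G v u) (allFin n)

isDominating-upClosed : ∀ (G : Graph n) → UpClosed (isDominating G)
isDominating-upClosed {n} G {S} {S′} S⊆S′ =
  all⁻ (dominated G S′) ∘ All.map (dominated-mono _) ∘ all⁺ (dominated G S) (allFin n)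
  where
  lookup-mono : ∀ u → T (lookup S u) → T (lookup S′ u)
  lookup-mono u = ∈⇒lookup ∘ S⊆S′ ∘ lookup⇒∈ S u
  dominated-mono : ∀ v → T (dominated G S v) → T (dominated G S′ v)
  dominated-mono v = from T-∨ ∘ Sum.map (lookup-mono v) neighbour-mono ∘ to T-∨
    where
    neighbour-mono : T (any (λ u → lookup S u ∧ adj G v u) (allFin n)) →
                     T (any (λ u → lookup S′ u ∧ adj G v u) (allFin n))
    neighbour-mono = any⁺ (λ u → lookup S′ u ∧ adj G v u)
                   ∘ Any.map (λ {u} → from T-∧ ∘ Product.map₁ (lookup-mono u) ∘ to T-∧)
                   ∘ any⁻ (λ u → lookup S u ∧ adj G v u) (allFin n)

neighbourhood : Graph n → Fin n → Subset n
neighbourhood G v = Vec.tabulate (adj G v)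

closedNeighbourhood : Graph n → Fin n → Subset n
closedNeighbourhood G v = ⁅ v ⁆ ∪ neighbourhood G v

∈-neighbourhood⁻ : ∀ (G : Graph n) {u v} → u ∈ neighbourhood G v → T (adj G v u)
∈-neighbourhood⁻ G {u} {v} u∈N = subst T (lookup∘tabulate (adj G v) u) (∈⇒lookup u∈N)

undominated⇒⊆∁closedNeighbourhood : ∀ (G : Graph n) S v →
  ¬ T (dominated G S v) → S ⊆ ∁ (closedNeighbourhood G v)
undominated⇒⊆∁closedNeighbourhood G S v undominated {x} x∈S =
  x∉p⇒x∈∁p ([ x∉⁅v⁆ , x∉N ] ∘ x∈p∪q⁻ ⁅ v ⁆ (neighbourhood G v))
  where
  x∉⁅v⁆ : ¬ x ∈ ⁅ v ⁆
  x∉⁅v⁆ x∈⁅v⁆ = undominated (from T-∨ (inj₁ (∈⇒lookup (subst (_∈ S) (x∈⁅y⁆⇒x≡y v x∈⁅v⁆) x∈S))))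
  x∉N : ¬ x ∈ neighbourhood G v
  x∉N x∈N = undominated (from T-∨ (inj₂ (any⁺ _ (tabulate⁺ x
              (from T-∧ (∈⇒lookup x∈S , ∈-neighbourhood⁻ G x∈N))))))

¬dominating⇒⊆∁closedNeighbourhood : ∀ (G : Graph n) S →
  ¬ T (isDominating G S) → ∃[ v ] S ⊆ ∁ (closedNeighbourhood G v)
¬dominating⇒⊆∁closedNeighbourhood {n} G S ¬dominating =
  Product.map₂ (undominated⇒⊆∁closedNeighbourhood G S _)
    (tabulate⁻ (¬All⇒Any¬ (T? ∘ dominated G S) (allFin n) (¬dominating ∘ all⁻ _)))

∣tabulate∣≡count : ∀ (f : A → Bool) (g : Fin n → A) → ∣ Vec.tabulate (f ∘ g) ∣ ≡ count f (List.tabulate g)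
∣tabulate∣≡count {n = zero}  f g = refl
∣tabulate∣≡count {n = suc n} f g with f (g zero)
... | true  = cong suc (∣tabulate∣≡count f (g ∘ suc))
... | false = ∣tabulate∣≡count f (g ∘ suc)

degree<∣closedNeighbourhood∣ : ∀ (G : Graph n) v → degree G v < ∣ closedNeighbourhood G v ∣
degree<∣closedNeighbourhood∣ G v =
  subst (_< ∣ closedNeighbourhood G v ∣) (∣tabulate∣≡count (adj G v) id)
    (p⊂q⇒∣p∣<∣q∣ (q⊆p∪q ⁅ v ⁆ (neighbourhood G v) , v , x∈p∪q⁺ (inj₁ (x∈⁅x⁆ v)) , v∉N))
  where
  v∉N : ¬ v ∈ neighbourhood G v
  v∉N v∈N = subst T (adj-irrefl G v) (∈-neighbourhood⁻ G v∈N)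

minDegree≤degree : ∀ (G : Graph n) v → minDegree G ≤ degree G v
minDegree≤degree {suc n} G v = foldr-⊓-≤ (degree G) (degree G zero) (∈-allFin v)

minDegree<∣closedNeighbourhood∣ : ∀ (G : Graph n) v → minDegree G < ∣ closedNeighbourhood G v ∣
minDegree<∣closedNeighbourhood∣ G v = ≤-<-trans (minDegree≤degree G v) (degree<∣closedNeighbourhood∣ G v)

minDegree<n : ∀ (G : Graph n) .{{_ : NonZero n}} → minDegree G < n
minDegree<n {suc n} G = <-≤-trans (minDegree<∣closedNeighbourhood∣ G zero) (∣p∣≤n (closedNeighbourhood G zero))

d≤nCi : ∀ (G : Graph n) i → d G i ≤ n C i
d≤nCi {n} G i = ≤-trans (countSubsets-mono {n} (λ _ _ → tt) i) (≤-reflexive (countSubsets-true i))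

nCi≤d+n*[n∸δ∸1]Ci : ∀ (G : Graph n) i → n C i ≤ d G i + n * ((n ∸ suc (minDegree G)) C i)
nCi≤d+n*[n∸δ∸1]Ci {n} G i = begin
  n C i                                     ≡⟨ countSubsets-true i ⟨
  countSubsets {n} (λ _ → true) i           ≤⟨ countSubsets-cover _ _ avoids i cover bound ⟩
  d G i + n * ((n ∸ suc (minDegree G)) C i) ∎
  where
  open ≤-Reasoning
  avoids : Fin n → Subset n → Bool
  avoids v S = does (S ⊆? ∁ (closedNeighbourhood G v))
  cover : ∀ S → T true → T (isDominating G S) ⊎ ∃[ v ] T (avoids v S)
  cover S _ with T? (isDominating G S)
  ... | yes dominating = inj₁ dominating
  ... | no ¬dominating = inj₂ (Product.map₂ ⊆⇒T-⊆? (¬dominating⇒⊆∁closedNeighbourhood G S ¬dominating))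
  bound : ∀ v → countSubsets (avoids v) i ≤ (n ∸ suc (minDegree G)) C i
  bound v = begin
    countSubsets (avoids v) i                  ≡⟨ countSubsets-⊆ (∁ (closedNeighbourhood G v)) i ⟩
    ∣ ∁ (closedNeighbourhood G v) ∣ C i        ≡⟨ cong (_C i) (∣∁p∣≡n∸∣p∣ (closedNeighbourhood G v)) ⟩
    (n ∸ ∣ closedNeighbourhood G v ∣) C i      ≤⟨ C-monoˡ-≤ i (∸-monoʳ-≤ n (minDegree<∣closedNeighbourhood∣ G v)) ⟩
    (n ∸ suc (minDegree G)) C i                ∎

d-decreasing : ∀ (G : Graph n) .{{_ : NonZero n}} → n * (n + 2) ≤ 2 ^ (minDegree G + 2) →
  ∀ {i} → n ≤ i + i → d G (suc i) ≤ d G i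
d-decreasing {n} G n[n+2]≤2^[δ+2] {i} n≤2i = +-cancelʳ-≤ (n * M) _ _ (begin
  d G (suc i) + n * M  ≤⟨ +-monoˡ-≤ (n * M) (d≤nCi G (suc i)) ⟩
  n C suc i + n * M    ≤⟨ nC[i+1]+n*M≤nCi ⟩
  n C i                ≤⟨ nCi≤d+n*[n∸δ∸1]Ci G i ⟩
  d G i + n * M        ∎)
  where
  open ≤-Reasoning
  δ = minDegree G
  M = (n ∸ suc δ) C i
  2^[δ+1]*M≤nCi : 2 ^ suc δ * M ≤ n C i
  2^[δ+1]*M≤nCi = begin
    2 ^ suc δ * M              ≤⟨ 2^a*nCk≤[n+a]Ck (suc δ) i (≤-trans (≤-reflexive n∸[δ+1]+[δ+1]≡n) n≤2i) ⟩
    (n ∸ suc δ + suc δ) C i    ≡⟨ cong (_C i) n∸[δ+1]+[δ+1]≡n ⟩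
    n C i                      ∎
    where
    n∸[δ+1]+[δ+1]≡n : n ∸ suc δ + suc δ ≡ n
    n∸[δ+1]+[δ+1]≡n = m∸n+n≡m (minDegree<n G)
  [n+2]*[n*M]≤2*nCi : (2 + n) * (n * M) ≤ 2 * (n C i)
  [n+2]*[n*M]≤2*nCi = begin
    (2 + n) * (n * M)      ≡⟨ reassoc n M ⟩
    n * (n + 2) * M        ≤⟨ *-monoˡ-≤ M n[n+2]≤2^[δ+2] ⟩
    2 ^ (δ + 2) * M        ≡⟨ cong (λ e → 2 ^ e * M) (+-comm δ 2) ⟩
    2 * 2 ^ suc δ * M      ≡⟨ *-assoc 2 (2 ^ suc δ) M ⟩
    2 * (2 ^ suc δ * M)    ≤⟨ *-monoʳ-≤ 2 2^[δ+1]*M≤nCi ⟩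
    2 * (n C i)            ∎
    where
    reassoc : ∀ n M → (2 + n) * (n * M) ≡ n * (n + 2) * M
    reassoc = solve-∀
  nC[i+1]+n*M≤nCi : n C suc i + n * M ≤ n C i
  nC[i+1]+n*M≤nCi = *-cancelˡ-≤ (2 + n) (begin
    (2 + n) * (n C suc i + n * M)             ≡⟨ *-distribˡ-+ (2 + n) (n C suc i) (n * M) ⟩
    (2 + n) * (n C suc i) + (2 + n) * (n * M) ≤⟨ +-mono-≤ ([n+2]*nC[k+1]≤n*nCk i n≤2i) [n+2]*[n*M]≤2*nCi ⟩
    n * (n C i) + 2 * (n C i)                 ≡⟨ *-distribʳ-+ (n C i) n 2 ⟨
    (n + 2) * (n C i)                         ≡⟨ cong (_* (n C i)) (+-comm n 2) ⟩
    (2 + n) * (n C i)                         ∎)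

i<⌈n/2⌉⇒2i+1≤n : ∀ n {i} → i < ceilHalf n → suc i + i ≤ n
i<⌈n/2⌉⇒2i+1≤n (suc zero)    {zero}  _         = s≤s z≤n
i<⌈n/2⌉⇒2i+1≤n (suc zero)    {suc i} (s≤s ())
i<⌈n/2⌉⇒2i+1≤n (suc (suc n)) {zero}  _         = s≤s z≤n
i<⌈n/2⌉⇒2i+1≤n (suc (suc n)) {suc i} (s≤s i<h) =
  s≤s (s≤s (subst (_≤ n) (sym (+-suc i i)) (i<⌈n/2⌉⇒2i+1≤n n i<h)))

⌈n/2⌉≤i⇒n≤2i : ∀ n {i} → ceilHalf n ≤ i → n ≤ i + i
⌈n/2⌉≤i⇒n≤2i zero          _         = z≤n
⌈n/2⌉≤i⇒n≤2i (suc zero)    {suc i} _ = s≤s z≤n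
⌈n/2⌉≤i⇒n≤2i (suc (suc n)) {suc i} (s≤s h≤i) =
  s≤s (subst (suc n ≤_) (sym (+-suc i i)) (s≤s (⌈n/2⌉≤i⇒n≤2i n h≤i)))

proposition13 : (n : ℕ) → 4 ≤ n → (G : Graph n) →
    n * (n + 2) ≤ 2 ^ (minDegree G + 2) →
    ((i : ℕ) → i < ceilHalf n → d G i ≤ d G (suc i)) ×
    ((i : ℕ) → ceilHalf n ≤ i → i < n → d G (suc i) ≤ d G i)
proposition13 (suc n) _ G n[n+2]≤2^[δ+2] = increasing , decreasing
  where
  increasing : ∀ i → i < ceilHalf (suc n) → d G i ≤ d G (suc i)
  increasing i i<⌈n/2⌉ =
    countSubsets-upClosed-increasing (isDominating-upClosed G) (i<⌈n/2⌉⇒2i+1≤n (suc n) i<⌈n/2⌉)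
  decreasing : ∀ i → ceilHalf (suc n) ≤ i → i < suc n → d G (suc i) ≤ d G i
  decreasing i ⌈n/2⌉≤i _ = d-decreasing G n[n+2]≤2^[δ+2] (⌈n/2⌉≤i⇒n≤2i (suc n) ⌈n/2⌉≤i)
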